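{- Every infinite word over a finite alphabet contains at least $4$ distinct palindromic factors (the empty word included).
   Context: A palindrome is a word equal to its reversal; factors are contiguous blocks; the empty word counts as a palindromic factor. -}

module Defs where

open import Data.Nat using (ℕ; zero; suc; _+_)
open import Data.List using (List; []; _∷_; reverse; length)
open import Data.Product using (∃)
open import Relation.Binary.PropositionalEquality using (_≡_)

InfWord : Set → Set
InfWord A = ℕ → A

block : {A : Set} → InfWord A → ℕ → ℕ → List A
block w i zero    = []
block w i (suc n) = w i ∷ block w (suc i) n

IsFactor : {A : Set} → List A → InfWord A → Set
IsFactor u w = ∃ λ i → block w i (length u) ≡ u

IsPalindrome : {A : Set} → List A → Set
IsPalindrome u = reverse u ≡ u

-- The empty word and the first letter are always palindromic factors. Among
-- the first three letters a b c, either a = b (so aa is one), or a = c (so abc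
-- is one), or b = c (so bc is one), or a, b, c are pairwise distinct letters.
-- In each case two further palindromes distinct from ε and a are found.
module Submission where

open import Defs
open import Data.Nat using (ℕ; zero; suc)
open import Data.Fin using (Fin; _≟_)
open import Data.List using (List; []; _∷_; length)
open import Data.List.Properties using (∷-injectiveˡ)
open import Data.Product using (Σ; _×_; _,_)
open import Data.Vec using (Vec; lookup)
  renaming ([] to []ᵥ; _∷_ to _∷ᵥ_)
open import Data.Vec.Relation.Unary.All using (All; []; _∷_)
open import Data.Vec.Relation.Unary.All.Properties using (lookup⁺)
open import Data.Vec.Relation.Unary.Unique.Propositional using (Unique; []; _∷_)
open import Data.Vec.Relation.Unary.Unique.Propositional.Properties using (lookup-injective)
open import Function using (_∘_)
open import Function.Definitions using (Injective)
open import Relation.Binary.Definitions using (DecidableEquality)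
open import Relation.Binary.PropositionalEquality using (_≡_; refl; cong)
open import Relation.Nullary using (yes; no)

PalindromicFactor : {A : Set} → InfWord A → List A → Set
PalindromicFactor w u = IsFactor u w × IsPalindrome u

module _ {A : Set} where

  length-block : (w : InfWord A) (i n : ℕ) → length (block w i n) ≡ n
  length-block w i zero    = refl
  length-block w i (suc n) = cong suc (length-block w (suc i) n)

  block-isFactor : (w : InfWord A) (i n : ℕ) → IsFactor (block w i n) w
  block-isFactor w i n = i , cong (block w i) (length-block w i n)

  palindrome₀ : IsPalindrome {A} []
  palindrome₀ = refl

  palindrome₁ : {x : A} → IsPalindrome (x ∷ [])
  palindrome₁ = refl

  palindrome₂ : {x y : A} → x ≡ y → IsPalindrome (x ∷ y ∷ [])
  palindrome₂ refl = refl

  palindrome₃ : {x y z : A} → x ≡ z → IsPalindrome (x ∷ y ∷ z ∷ [])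
  palindrome₃ refl = refl

  palindromicBlock : (w : InfWord A) (i n : ℕ) →
    IsPalindrome (block w i n) → PalindromicFactor w (block w i n)
  palindromicBlock w i n pal = block-isFactor w i n , pal

  lookup-uniqueFamily : {n : ℕ} {w : InfWord A} (us : Vec (List A) n) →
    Unique us → All (PalindromicFactor w) us →
    Σ (Fin n → List A) λ f →
      Injective _≡_ _≡_ f × ((j : Fin n) → IsFactor (f j) w × IsPalindrome (f j))
  lookup-uniqueFamily us unique pals =
    lookup us , lookup-injective unique _ _ , lookup⁺ pals

  -- Distinctness is witnessed by differing lengths or differing single letters.
  fourPalindromicFactors : DecidableEquality A → (w : InfWord A) →
    Σ (Vec (List A) 4) λ us → Unique us × All (PalindromicFactor w) us
  fourPalindromicFactors _≟ᴬ_ w with w 0 ≟ᴬ w 1 | w 0 ≟ᴬ w 2 | w 1 ≟ᴬ w 2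
  ... | yes w₀≡w₁ | yes w₀≡w₂ | _ =
    block w 0 0 ∷ᵥ block w 0 1 ∷ᵥ block w 0 2 ∷ᵥ block w 0 3 ∷ᵥ []ᵥ ,
    ((λ ()) ∷ (λ ()) ∷ (λ ()) ∷ []) ∷ ((λ ()) ∷ (λ ()) ∷ []) ∷ ((λ ()) ∷ []) ∷ [] ∷ [] ,
    palindromicBlock w 0 0 palindrome₀ ∷ palindromicBlock w 0 1 palindrome₁ ∷
    palindromicBlock w 0 2 (palindrome₂ w₀≡w₁) ∷ palindromicBlock w 0 3 (palindrome₃ w₀≡w₂) ∷ []
  ... | yes w₀≡w₁ | no w₀≢w₂ | _ =
    block w 0 0 ∷ᵥ block w 0 1 ∷ᵥ block w 0 2 ∷ᵥ block w 2 1 ∷ᵥ []ᵥ ,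
    ((λ ()) ∷ (λ ()) ∷ (λ ()) ∷ []) ∷ ((λ ()) ∷ w₀≢w₂ ∘ ∷-injectiveˡ ∷ []) ∷ ((λ ()) ∷ []) ∷ [] ∷ [] ,
    palindromicBlock w 0 0 palindrome₀ ∷ palindromicBlock w 0 1 palindrome₁ ∷
    palindromicBlock w 0 2 (palindrome₂ w₀≡w₁) ∷ palindromicBlock w 2 1 palindrome₁ ∷ []
  ... | no w₀≢w₁ | yes w₀≡w₂ | _ =
    block w 0 0 ∷ᵥ block w 0 1 ∷ᵥ block w 1 1 ∷ᵥ block w 0 3 ∷ᵥ []ᵥ ,
    ((λ ()) ∷ (λ ()) ∷ (λ ()) ∷ []) ∷ (w₀≢w₁ ∘ ∷-injectiveˡ ∷ (λ ()) ∷ []) ∷ ((λ ()) ∷ []) ∷ [] ∷ [] ,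
    palindromicBlock w 0 0 palindrome₀ ∷ palindromicBlock w 0 1 palindrome₁ ∷
    palindromicBlock w 1 1 palindrome₁ ∷ palindromicBlock w 0 3 (palindrome₃ w₀≡w₂) ∷ []
  ... | no w₀≢w₁ | no _ | yes w₁≡w₂ =
    block w 0 0 ∷ᵥ block w 0 1 ∷ᵥ block w 1 1 ∷ᵥ block w 1 2 ∷ᵥ []ᵥ ,
    ((λ ()) ∷ (λ ()) ∷ (λ ()) ∷ []) ∷ (w₀≢w₁ ∘ ∷-injectiveˡ ∷ (λ ()) ∷ []) ∷ ((λ ()) ∷ []) ∷ [] ∷ [] ,
    palindromicBlock w 0 0 palindrome₀ ∷ palindromicBlock w 0 1 palindrome₁ ∷
    palindromicBlock w 1 1 palindrome₁ ∷ palindromicBlock w 1 2 (palindrome₂ w₁≡w₂) ∷ []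
  ... | no w₀≢w₁ | no w₀≢w₂ | no w₁≢w₂ =
    block w 0 0 ∷ᵥ block w 0 1 ∷ᵥ block w 1 1 ∷ᵥ block w 2 1 ∷ᵥ []ᵥ ,
    ((λ ()) ∷ (λ ()) ∷ (λ ()) ∷ []) ∷
      (w₀≢w₁ ∘ ∷-injectiveˡ ∷ w₀≢w₂ ∘ ∷-injectiveˡ ∷ []) ∷ (w₁≢w₂ ∘ ∷-injectiveˡ ∷ []) ∷ [] ∷ [] ,
    palindromicBlock w 0 0 palindrome₀ ∷ palindromicBlock w 0 1 palindrome₁ ∷
    palindromicBlock w 1 1 palindrome₁ ∷ palindromicBlock w 2 1 palindrome₁ ∷ []

mainTheorem4 : (k : ℕ) → (w : InfWord (Fin k)) →
    Σ (Fin 4 → List (Fin k)) λ f →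
      Injective _≡_ _≡_ f × ((j : Fin 4) → IsFactor (f j) w × IsPalindrome (f j))
mainTheorem4 k w with fourPalindromicFactors _≟_ w
... | us , unique , pals = lookup-uniqueFamily us unique pals
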